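{- Let $\mathcal N$ be a network of timed automata. If $(q,\nu)\Rightarrow^u(q',\nu')$ is a local run where $\nu$ and $\nu'$ are synchronized local valuations, then there exist a word $w\sim u$ and a global run $(q,\mathrm{global}(\nu))\xrightarrow{w}(q',\mathrm{global}(\nu'))$.
   Context: Network: $\mathcal N=\langle A_1,\dots,A_k\rangle$, each $A_p=(Q_p,\Sigma_p,X_p,q^{init}_p,T_p)$ with finite state set $Q_p$, finite alphabet $\Sigma_p$, finite clock set $X_p$, initial state $q^{init}_p$, transitions $T_p\subseteq\Sigma_p\times Q_p\times\Phi(X_p)\times2^{X_p}\times Q_p$ with $\Phi(X_p)$ finite conjunctions of atoms $x\sim c$ ($c\in\mathbb N$, $\sim\in\{<,\le,=,\ge,>\}$). $Q_p$ pairwise disjoint, $X_p$ pairwise disjoint; $Q=\prod_pQ_p$, $q(p)$ the $p$-th component, $\Sigma=\bigcup\Sigma_p$, $X=\bigcup X_p$, $\mathrm{dom}(b)=\{p:b\in\Sigma_p\}$. $u\sim w$ means one word is obtained from the other by repeatedly swapping adjacent actions $a,b$ with $\mathrm{dom}(a)\cap\mathrm{dom}(b)=\emptyset$. Offset variables $\tilde x$ for $x\in X$, $\tilde X_p=\{\tilde x:x\in X_p\}$, $\tilde X=\bigcup\tilde X_p$. Global semantics: a global valuation is $v:\tilde X\cup\{t\}\to\mathbb R_{\ge0}$ with $v(t)\ge v(\tilde x)$; clock $x$ has value $v(t)-v(\tilde x)$, $v\models g$ defined by these values; $v+\delta$ adds $\delta$ to $t$ only; $[R]v$ sets $\tilde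 x:=v(t)$ for $x\in R$. Steps $(q,v)\xrightarrow{\delta}(q,v+\delta)$, and $(q,v)\xrightarrow{b}(q',v')$ if there are $b$-transitions $(b,q_p,g_p,R_p,q'_p)\in T_p$, $p\in\mathrm{dom}(b)$, with $q_p=q(p)$, $q'_p=q'(p)$ for $p\in\mathrm{dom}(b)$, $q'(p)=q(p)$ otherwise, $v\models g_p$, $v'=[\bigcup_pR_p]v$. For $u=b_1\cdots b_n$, $(q_0,v_0)\xrightarrow{u}(q_n,v_n')$ means there are delays $\delta_0,\dots,\delta_n\ge0$ with $(q_0,v_0)\xrightarrow{\delta_0}\xrightarrow{b_1}\xrightarrow{\delta_1}\cdots\xrightarrow{b_n}\xrightarrow{\delta_n}(q_n,v_n')$. Local semantics: reference clock $t_p$ per process; a local valuation is $\nu:\tilde X\cup\{t_1,\dots,t_k\}\to\mathbb R_{\ge0}$ with $\nu(t_p)\ge\nu(\tilde x)$ for $\tilde x\in\tilde X_p$; value of $x\in X_p$ is $\nu(t_p)-\nu(\tilde x)$; $\nu+_p\delta$ adds $\delta$ to $t_p$ only; $[R]\nu$ sets $\tilde x:=\nu(t_p)$ for $x\in R\cap X_p$. Local steps: $(q,\nu)\Rightarrow_{p,\delta}(q,\nu+_p\delta)$; $(q,\nu)\Rightarrow_b(q',\nu')$ under the same conditions as global action steps with $v$ replaced by $\nu$, plus $\nu(t_{p_1})=\nu(t_{p_2})$ for all $p_1,p_2\in\mathrm{dom}(b)$. $(q_0,\nu_0)\Rightarrow^u(q_n,\nu_n')$ means $(q_0,\nu_0)\Rightarrow_{\Delta_0}\Rightarrow_{b_1}\Rightarrow_{\Delta_1}\cdots\Rightarrow_{b_n}\Rightarrow_{\Delta_n}(q_n,\nu'_n)$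 for finite sequences of local delays $\Delta_i$ applied successively. $\nu$ is synchronized if $\nu(t_1)=\dots=\nu(t_k)$; then $\mathrm{global}(\nu)$ is the global valuation with the same offsets and $t$ equal to this common value. -}

module Defs where

open import Data.Nat using (ℕ; zero; suc)
open import Data.Fin using (Fin)
open import Data.Fin.Subset using (Subset; _∈_)
open import Data.Bool using (Bool; true; false)
open import Data.List using (List; []; _∷_; _++_)
import Data.List.Membership.Propositional as LM
open import Data.List.Relation.Unary.All using (All)
open import Data.Product using (Σ; ∃; _×_; _,_)
open import Relation.Nullary using (¬_)
open import Relation.Binary.PropositionalEquality using (_≡_; _≢_)
open import Relation.Binary.Structures using (IsTotalOrder)
open import Relation.Binary.Construct.Closure.ReflexiveTransitive using (Star)
open import Algebra.Structures using (IsCommutativeRing)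

-- Time domain: a linearly ordered field (ℝ is the intended instance).
-- Time values / clock values are the non-negative elements.

record OrderedField : Set₁ where
  infixl 6 _+_
  infixl 7 _*_
  infix 4 _≤_
  field
    Carrier : Set
    _+_ _*_ : Carrier → Carrier → Carrier
    -_      : Carrier → Carrier
    0# 1#   : Carrier
    _≤_     : Carrier → Carrier → Set
    isCommutativeRing : IsCommutativeRing _≡_ _+_ _*_ -_ 0# 1#
    isTotalOrder      : IsTotalOrder _≡_ _≤_
    +-mono-≤  : ∀ {x y} z → x ≤ y → x + z ≤ y + z
    *-nonneg  : ∀ {x y} → 0# ≤ x → 0# ≤ y → 0# ≤ x * y
    0≢1       : 0# ≢ 1#
    inverse   : ∀ x → x ≢ 0# → ∃ λ y → x * y ≡ 1#

  _-_ : Carrier → Carrier → Carrier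
  x - y = x + (- y)

  _<_ : Carrier → Carrier → Set
  x < y = x ≤ y × x ≢ y

  fromℕ : ℕ → Carrier
  fromℕ zero    = 0#
  fromℕ (suc n) = 1# + fromℕ n

-- Processes are Fin k with k = suc k'
-- (a network has at least one process).  States of process p are
-- Fin (nQ p), clocks of p are Fin (nX p) (so the Q_p and X_p are
-- pairwise disjoint by construction).  The global alphabet is Fin nΣ;
-- letter b belongs to Σ_p iff inΣ p b ≡ true; every letter belongs to
-- some Σ_p (Σ = ⋃ Σ_p).

data Cmp : Set where
  lt le eq ge gt : Cmp

record Network : Set where
  field
    k'   : ℕ
    nQ   : Fin (suc k') → ℕ
    nX   : Fin (suc k') → ℕ
    nΣ   : ℕ
    inΣ  : Fin (suc k') → Fin nΣ → Bool
    Σ-cover : ∀ b → ∃ λ p → inΣ p b ≡ true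
    qinit : (p : Fin (suc k')) → Fin (nQ p)

  k : ℕ
  k = suc k'

  Proc : Set
  Proc = Fin k

  record Atom (p : Proc) : Set where
    constructor atom
    field
      clk : Fin (nX p)
      cmp : Cmp
      const : ℕ

  Guard : Proc → Set
  Guard p = List (Atom p)

  record Trans (p : Proc) : Set where
    constructor trans
    field
      act   : Fin nΣ
      src   : Fin (nQ p)
      guard : Guard p
      reset : Subset (nX p)
      tgt   : Fin (nQ p)

  dom : Fin nΣ → Proc → Set
  dom b p = inΣ p b ≡ true

  Word : Set
  Word = List (Fin nΣ)

  GState : Set
  GState = (p : Proc) → Fin (nQ p)

  Disjoint : Fin nΣ → Fin nΣ → Set
  Disjoint a b = ∀ p → dom a p → ¬ dom b p

  data Swap : Word → Word → Set where
    swap : ∀ xs a b ys → Disjoint a b →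
           Swap (xs ++ a ∷ b ∷ ys) (xs ++ b ∷ a ∷ ys)

  _∼_ : Word → Word → Set
  _∼_ = Star Swap

record NetworkOver (F : OrderedField) : Set where
  field
    net : Network
  open Network net public
  open OrderedField F public
  field
    T      : (p : Proc) → List (Trans p)
    T-wf   : ∀ p τ → τ LM.∈ T p → dom (Trans.act τ) p

  Time : Set
  Time = Carrier

  sat : Carrier → Cmp → ℕ → Set
  sat r lt c = r < fromℕ c
  sat r le c = r ≤ fromℕ c
  sat r eq c = r ≡ fromℕ c
  sat r ge c = fromℕ c ≤ r
  sat r gt c = fromℕ c < r

  Offsets : Set
  Offsets = (p : Proc) → Fin (nX p) → Carrier

  record GVal : Set where
    field
      off : Offsets
      t   : Carrier
  open GVal public

  IsGVal : GVal → Set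
  IsGVal v = 0# ≤ t v × (∀ p x → 0# ≤ off v p x × off v p x ≤ t v)

  gsatG : GVal → (p : Proc) → Guard p → Set
  gsatG v p g = All (λ a → sat (t v - off v p (Atom.clk a)) (Atom.cmp a) (Atom.const a)) g

  GConf : Set
  GConf = GState × GVal

  GDelay : GConf → Carrier → GConf → Set
  GDelay (q , v) δ (q' , v') =
    0# ≤ δ × (∀ p → q' p ≡ q p) × (∀ p x → off v' p x ≡ off v p x) × t v' ≡ t v + δ

  GAct : GConf → Fin nΣ → GConf → Set
  GAct (q , v) b (q' , v') =
    Σ ((p : Proc) → dom b p → Trans p) λ τ →
      (∀ p (d : dom b p) →
          τ p d LM.∈ T p × Trans.act (τ p d) ≡ b × Trans.src (τ p d) ≡ q p ×
          Trans.tgt (τ p d) ≡ q' p × gsatG v p (Trans.guard (τ p d)) ×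
          (∀ x → (x ∈ Trans.reset (τ p d) → off v' p x ≡ t v) ×
                 (¬ x ∈ Trans.reset (τ p d) → off v' p x ≡ off v p x))) ×
      (∀ p → ¬ dom b p → q' p ≡ q p × (∀ x → off v' p x ≡ off v p x)) ×
      t v' ≡ t v

  GRun : GConf → Word → GConf → Set
  GRun c [] c' = ∃ λ δ → GDelay c δ c'
  GRun c (b ∷ u) c' = ∃ λ δ → ∃ λ c₁ → ∃ λ c₂ →
    GDelay c δ c₁ × GAct c₁ b c₂ × GRun c₂ u c'

  record LVal : Set where
    field
      loff : Offsets
      tl   : Proc → Carrier
  open LVal public

  IsLVal : LVal → Set
  IsLVal ν = ∀ p → 0# ≤ tl ν p × (∀ x → 0# ≤ loff ν p x × loff ν p x ≤ tl ν p)

  lsatG : LVal → (p : Proc) → Guard p → Set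
  lsatG ν p g = All (λ a → sat (tl ν p - loff ν p (Atom.clk a)) (Atom.cmp a) (Atom.const a)) g

  LConf : Set
  LConf = GState × LVal

  LDelay : LConf → Proc → Carrier → LConf → Set
  LDelay (q , ν) p δ (q' , ν') =
    0# ≤ δ × (∀ r → q' r ≡ q r) × (∀ r x → loff ν' r x ≡ loff ν r x) ×
    tl ν' p ≡ tl ν p + δ × (∀ r → r ≢ p → tl ν' r ≡ tl ν r)

  data LDelays : LConf → List (Proc × Carrier) → LConf → Set where
    done : ∀ {q ν q' ν'} → (∀ r → q' r ≡ q r) → (∀ r x → loff ν' r x ≡ loff ν r x) →
           (∀ r → tl ν' r ≡ tl ν r) → LDelays (q , ν) [] (q' , ν')
    step : ∀ {c c₁ c' p δ Δ} → LDelay c p δ c₁ → LDelays c₁ Δ c' →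
           LDelays c ((p , δ) ∷ Δ) c'

  LAct : LConf → Fin nΣ → LConf → Set
  LAct (q , ν) b (q' , ν') =
    (∀ p₁ p₂ → dom b p₁ → dom b p₂ → tl ν p₁ ≡ tl ν p₂) ×
    Σ ((p : Proc) → dom b p → Trans p) λ τ →
      (∀ p (d : dom b p) →
          τ p d LM.∈ T p × Trans.act (τ p d) ≡ b × Trans.src (τ p d) ≡ q p ×
          Trans.tgt (τ p d) ≡ q' p × lsatG ν p (Trans.guard (τ p d)) ×
          (∀ x → (x ∈ Trans.reset (τ p d) → loff ν' p x ≡ tl ν p) ×
                 (¬ x ∈ Trans.reset (τ p d) → loff ν' p x ≡ loff ν p x))) ×
      (∀ p → ¬ dom b p → q' p ≡ q p × (∀ x → loff ν' p x ≡ loff ν p x)) ×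
      (∀ p → tl ν' p ≡ tl ν p)

  LRun : LConf → Word → LConf → Set
  LRun c [] c' = ∃ λ Δ → LDelays c Δ c'
  LRun c (b ∷ u) c' = ∃ λ Δ → ∃ λ c₁ → ∃ λ c₂ →
    LDelays c Δ c₁ × LAct c₁ b c₂ × LRun c₂ u c'

  Synchronized : LVal → Set
  Synchronized ν = ∀ p₁ p₂ → tl ν p₁ ≡ tl ν p₂

  global : LVal → GVal
  global ν = record { off = loff ν ; t = tl ν Fin.zero }
    where import Data.Fin as Fin

module Submission where

-- Each action of a local run happens at a well-defined time: the common local
-- time of its participants. Per process these times are nondecreasing, so the
-- run is a schedule of timed actions that is chronological on every process.
-- Insertion-sort it by time: two adjacent actions that are out of order cannot
-- share a process, so they are independent and may be swapped, changing the
-- word only up to ∼. A globally chronological schedule is a global run: delay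
-- until the time of each action, then perform it.

open import Defs
open import Data.Bool using (Bool; true; false; if_then_else_)
import Data.Bool.Properties as Bool
open import Data.Bool.Properties using (¬-not; not-¬)
open import Data.Empty using (⊥-elim)
open import Data.Fin using (Fin; zero)
open import Data.Fin.Properties using (_≟_; any?)
open import Data.Fin.Subset using (_∈_)
open import Data.List using ([]; _∷_)
import Data.List.Membership.Propositional as List
open import Data.List.Relation.Unary.All as All using (All)
open import Data.Product using (∃; _×_; _,_; proj₁; proj₂)
open import Data.Sum using (_⊎_; inj₁; inj₂)
open import Relation.Nullary using (¬_; Dec; yes; no)
open import Relation.Nullary.Decidable using (_×-dec_)
open import Relation.Binary.PropositionalEquality
  using (_≡_; refl; sym; trans; cong; subst; subst₂; module ≡-Reasoning)
open import Relation.Binary.Structures using (IsTotalOrder)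
open import Relation.Binary.Construct.Closure.ReflexiveTransitive using (ε; _◅_; _◅◅_; gmap)
open import Algebra.Structures using (IsCommutativeRing)

module OrderedFieldProperties (F : OrderedField) where
  open OrderedField F
  open IsCommutativeRing isCommutativeRing
    using (+-comm; +-assoc; +-identityˡ; -‿inverseʳ)

  x≤x+y : ∀ x {y} → 0# ≤ y → x ≤ x + y
  x≤x+y x {y} 0≤y = subst₂ _≤_ (+-identityˡ x) (+-comm y x) (+-mono-≤ x 0≤y)

  x≤y⇒0≤y-x : ∀ {x y} → x ≤ y → 0# ≤ y - x
  x≤y⇒0≤y-x {x} {y} x≤y = subst (_≤ y - x) (-‿inverseʳ x) (+-mono-≤ (- x) x≤y)

  x+[y-x]≡y : ∀ x y → x + (y - x) ≡ y
  x+[y-x]≡y x y = begin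
    x + (y + - x)   ≡⟨ cong (x +_) (+-comm y (- x)) ⟩
    x + (- x + y)   ≡⟨ sym (+-assoc x (- x) y) ⟩
    (x + - x) + y   ≡⟨ cong (_+ y) (-‿inverseʳ x) ⟩
    0# + y          ≡⟨ +-identityˡ y ⟩
    y               ∎
    where open ≡-Reasoning

module LocalToGlobal (F : OrderedField) (N : NetworkOver F) where
  open NetworkOver N hiding (trans)
  open OrderedFieldProperties F
  open IsTotalOrder isTotalOrder using (total)
    renaming (refl to ≤-refl; trans to ≤-trans; reflexive to ≤-reflexive)

  ∼-cons : ∀ a {u w} → u ∼ w → (a ∷ u) ∼ (a ∷ w)
  ∼-cons a = gmap (a ∷_) λ { (swap xs x y ys d) → swap (a ∷ xs) x y ys d }

  -- The clock of a process is a lower bound for the time of its next action.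
  record PConf (p : Proc) : Set where
    constructor ⟨_,_,_⟩
    field
      state  : Fin (nQ p)
      offset : Fin (nX p) → Carrier
      clock  : Carrier
  open PConf

  Conf : Set
  Conf = (p : Proc) → PConf p

  conf : GState → LVal → Conf
  conf q ν p = ⟨ q p , loff ν p , tl ν p ⟩

  states : Conf → GState
  states c p = state (c p)

  gval : Conf → Carrier → GVal
  gval c θ = record { off = λ p → offset (c p) ; t = θ }

  record _≼_ {p} (l l' : PConf p) : Set where
    constructor idle
    field
      ≼-state  : state l' ≡ state l
      ≼-offset : ∀ x → offset l' x ≡ offset l x
      ≼-clock  : clock l ≤ clock l'
  open _≼_

  ≼-refl : ∀ {p} {l : PConf p} → l ≼ l
  ≼-refl = idle refl (λ _ → refl) ≤-refl

  ≼-trans : ∀ {p} {l₀ l₁ l₂ : PConf p} → l₀ ≼ l₁ → l₁ ≼ l₂ → l₀ ≼ l₂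
  ≼-trans (idle s₁ o₁ c₁) (idle s₂ o₂ c₂) =
    idle (trans s₂ s₁) (λ x → trans (o₂ x) (o₁ x)) (≤-trans c₁ c₂)

  record Fires {p} (b : Fin nΣ) (τ : Carrier) (tr : Trans p) (l l' : PConf p) : Set where
    constructor fires
    field
      ∈T    : tr List.∈ T p
      act   : Trans.act tr ≡ b
      src   : Trans.src tr ≡ state l
      tgt   : Trans.tgt tr ≡ state l'
      guard : All (λ a → sat (τ - offset l (Atom.clk a)) (Atom.cmp a) (Atom.const a)) (Trans.guard tr)
      reset : ∀ x → (x ∈ Trans.reset tr → offset l' x ≡ τ) ×
                    (¬ x ∈ Trans.reset tr → offset l' x ≡ offset l x)

  Fires-resp-≼ : ∀ {p b τ tr} {l₀ l₁ l₂ l₃ : PConf p} →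
                 l₀ ≼ l₁ → Fires b τ tr l₁ l₂ → l₂ ≼ l₃ → Fires b τ tr l₀ l₃
  Fires-resp-≼ {τ = τ} (idle s₀ o₀ _) (fires ∈T act src tgt guard reset) (idle s₃ o₃ _) =
    fires ∈T act (trans src s₀) (trans tgt (sym s₃))
      (All.map (λ {a} → subst (λ y → sat (τ - y) (Atom.cmp a) (Atom.const a)) (o₀ (Atom.clk a))) guard)
      λ x → (λ r → trans (o₃ x) (proj₁ (reset x) r)) ,
            (λ ¬r → trans (o₃ x) (trans (proj₂ (reset x) ¬r) (o₀ x)))

  record Moves {p} (b : Fin nΣ) (τ : Carrier) (l l' : PConf p) : Set where
    constructor moves
    field
      ready      : clock l ≤ τ
      transition : Trans p
      firing     : Fires b τ transition l l'
      after      : τ ≤ clock l'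
  open Moves

  PStep : ∀ {p} → Bool → Fin nΣ → Carrier → PConf p → PConf p → Set
  PStep true  b τ l l' = Moves b τ l l'
  PStep false b τ l l' = l ≼ l'

  PStep-resp-≼ˡ : ∀ {p} β {b τ} {l₀ l₁ l₂ : PConf p} →
                  l₀ ≼ l₁ → PStep β b τ l₁ l₂ → PStep β b τ l₀ l₂
  PStep-resp-≼ˡ true  l₀≼l₁ (moves ready tr firing after) =
    moves (≤-trans (≼-clock l₀≼l₁) ready) tr (Fires-resp-≼ l₀≼l₁ firing ≼-refl) after
  PStep-resp-≼ˡ false l₀≼l₁ l₁≼l₂ = ≼-trans l₀≼l₁ l₁≼l₂

  PStep-clock-mono : ∀ {p} β {b τ} {l l' : PConf p} → PStep β b τ l l' → clock l ≤ clock l'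
  PStep-clock-mono true  m = ≤-trans (ready m) (after m)
  PStep-clock-mono false = ≼-clock

  -- A process involved in at most one of two consecutive actions can perform
  -- them in either order; it idles in the intermediate configuration chosen here.
  PStep-commute : ∀ {p} βa βb {a b τ σ} {l₀ l₁ l₂ : PConf p} → (βa ≡ true → ¬ βb ≡ true) →
                  PStep βa a τ l₀ l₁ → PStep βb b σ l₁ l₂ →
                  PStep βb b σ l₀ (if βb then l₂ else l₀) × PStep βa a τ (if βb then l₂ else l₀) l₂
  PStep-commute true  true  disj _ _ = ⊥-elim (disj refl refl)
  PStep-commute true  false _ (moves ready tr firing after) l₁≼l₂ =
    ≼-refl , moves ready tr (Fires-resp-≼ ≼-refl firing l₁≼l₂) (≤-trans after (≼-clock l₁≼l₂))
  PStep-commute false true  _ l₀≼l₁ m₁₂ = PStep-resp-≼ˡ true l₀≼l₁ m₁₂ , ≼-refl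
  PStep-commute false false _ l₀≼l₁ l₁≼l₂ = ≼-refl , ≼-trans l₀≼l₁ l₁≼l₂

  Step : Fin nΣ → Carrier → Conf → Conf → Set
  Step b τ c c' = ∀ p → PStep (inΣ p b) b τ (c p) (c' p)

  module _ {b : Fin nΣ} {τ : Carrier} {c c' : Conf} where

    Step-intro : (∀ p → dom b p → Moves b τ (c p) (c' p)) → (∀ p → ¬ dom b p → c p ≼ c' p) →
                 Step b τ c c'
    Step-intro move stay p with inΣ p b in eq
    ... | true  = move p eq
    ... | false = stay p (not-¬ eq)

    participant : Step b τ c c' → ∀ {p} → dom b p → Moves b τ (c p) (c' p)
    participant s {p} d = subst (λ β → PStep β b τ (c p) (c' p)) d (s p)

    bystander : Step b τ c c' → ∀ {p} → ¬ dom b p → c p ≼ c' p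
    bystander s {p} ¬d = subst (λ β → PStep β b τ (c p) (c' p)) (¬-not ¬d) (s p)

    Step-clock-mono : Step b τ c c' → ∀ p → clock (c p) ≤ clock (c' p)
    Step-clock-mono s p = PStep-clock-mono (inΣ p b) (s p)

    Step-resp-≼ˡ : ∀ {c₀} → (∀ p → c₀ p ≼ c p) → Step b τ c c' → Step b τ c₀ c'
    Step-resp-≼ˡ c₀≼c s p = PStep-resp-≼ˡ (inΣ p b) (c₀≼c p) (s p)

    -- Every action has a participant (Σ-cover), whose clock bounds its time.
    Step-time-lower : ∀ {θ} → (∀ p → θ ≤ clock (c p)) → Step b τ c c' → θ ≤ τ
    Step-time-lower θ≤c s = let (p , d) = Σ-cover b in ≤-trans (θ≤c p) (ready (participant s d))

    Step-time-upper : ∀ {θ} → Step b τ c c' → (∀ p → clock (c' p) ≤ θ) → τ ≤ θ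
    Step-time-upper s c'≤θ = let (p , d) = Σ-cover b in ≤-trans (after (participant s d)) (c'≤θ p)

  Step-commute : ∀ {a b τ σ c₀ c₁ c₂} → Disjoint a b → Step a τ c₀ c₁ → Step b σ c₁ c₂ →
                 ∃ λ c₁' → Step b σ c₀ c₁' × Step a τ c₁' c₂
  Step-commute {a} {b} {c₀ = c₀} {c₂ = c₂} disj sa sb =
    (λ p → if inΣ p b then c₂ p else c₀ p) ,
    (λ p → proj₁ (PStep-commute (inΣ p a) (inΣ p b) (disj p) (sa p) (sb p))) ,
    (λ p → proj₂ (PStep-commute (inΣ p a) (inΣ p b) (disj p) (sa p) (sb p)))

  dom? : ∀ b p → Dec (dom b p)
  dom? b p = inΣ p b Bool.≟ true

  inOrder⊎swappable : ∀ {a b τ σ c₀ c₁ c₂} → Step a τ c₀ c₁ → Step b σ c₁ c₂ →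
                      τ ≤ σ ⊎ (Disjoint a b × σ ≤ τ)
  inOrder⊎swappable {a} {b} {τ} {σ} sa sb with total τ σ
  ... | inj₁ τ≤σ = inj₁ τ≤σ
  ... | inj₂ σ≤τ with any? (λ p → dom? a p ×-dec dom? b p)
  ...   | yes (p , da , db) = inj₁ (≤-trans (after (participant sa da)) (ready (participant sb db)))
  ...   | no ¬shared        = inj₂ ((λ p da db → ¬shared (p , da , db)) , σ≤τ)

  Step⇒GAct : ∀ {b τ c c'} → Step b τ c c' → GAct (states c , gval c τ) b (states c' , gval c' τ)
  Step⇒GAct s =
    (λ p d → transition (participant s d)) ,
    (λ p d → let fires ∈T act src tgt guard reset = firing (participant s d)
             in ∈T , act , src , tgt , guard , reset) ,
    (λ p ¬d → ≼-state (bystander s ¬d) , ≼-offset (bystander s ¬d)) ,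
    refl

  GDelay-up-to : ∀ {q v q' v'} → t v ≤ t v' → (∀ p → q' p ≡ q p) → (∀ p x → off v' p x ≡ off v p x) →
                 GDelay (q , v) (t v' - t v) (q' , v')
  GDelay-up-to {v = v} {v' = v'} t≤t' same-q same-off =
    x≤y⇒0≤y-x t≤t' , same-q , same-off , sym (x+[y-x]≡y (t v) (t v'))

  LDelay⇒≼ : ∀ {q ν r δ q' ν'} → LDelay (q , ν) r δ (q' , ν') → ∀ p → conf q ν p ≼ conf q' ν' p
  LDelay⇒≼ {ν = ν} {r} (0≤δ , same-q , same-off , t-r , t-others) p with p ≟ r
  ... | yes refl = idle (same-q p) (same-off p) (subst (tl ν p ≤_) (sym t-r) (x≤x+y (tl ν p) 0≤δ))
  ... | no p≢r   = idle (same-q p) (same-off p) (≤-reflexive (sym (t-others p p≢r)))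

  LDelays⇒≼ : ∀ {q ν Δ q' ν'} → LDelays (q , ν) Δ (q' , ν') → ∀ p → conf q ν p ≼ conf q' ν' p
  LDelays⇒≼ (done same-q same-off same-t) p =
    idle (same-q p) (same-off p) (≤-reflexive (sym (same-t p)))
  LDelays⇒≼ (step d ds) p = ≼-trans (LDelay⇒≼ d p) (LDelays⇒≼ ds p)

  -- All participants of a local action share the local time of p₀.
  LAct⇒Step : ∀ {q ν b q' ν' p₀} → dom b p₀ → LAct (q , ν) b (q' , ν') →
              Step b (tl ν p₀) (conf q ν) (conf q' ν')
  LAct⇒Step {q} {ν} {b} {q'} {ν'} {p₀} d₀ (synced , tr , move , stay , same-t) = Step-intro
    (λ p d → let (∈T , act , src , tgt , guard , reset) = move p d
                 e = synced p p₀ d d₀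
             in moves (≤-reflexive e) (tr p d)
                  (subst (λ θ → Fires b θ (tr p d) (conf q ν p) (conf q' ν' p)) e
                     (fires ∈T act src tgt guard reset))
                  (≤-reflexive (trans (sym e) (sym (same-t p)))))
    (λ p ¬d → let (same-q , same-off) = stay p ¬d
              in idle same-q same-off (≤-reflexive (sym (same-t p))))

  module _ (q' : GState) (v' : GVal) where

    Done : Conf → Set
    Done c = ∀ p → c p ≼ ⟨ q' p , off v' p , t v' ⟩

    data Schedule : Conf → Word → Set where
      end : ∀ {c} → Done c → Schedule c []
      _∷_ : ∀ {b τ c c₁ u} → Step b τ c c₁ → Schedule c₁ u → Schedule c (b ∷ u)

    -- θ is the time of the preceding action.
    data SortedSchedule (θ : Carrier) : Conf → Word → Set where
      end  : ∀ {c} → θ ≤ t v' → Done c → SortedSchedule θ c []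
      step : ∀ {b τ c c₁ u} → θ ≤ τ → Step b τ c c₁ → SortedSchedule τ c₁ u → SortedSchedule θ c (b ∷ u)

    insert : ∀ {θ a τ c₀ c₁ w} → θ ≤ τ → Step a τ c₀ c₁ → SortedSchedule θ c₁ w →
             ∃ λ w' → w' ∼ (a ∷ w) × SortedSchedule θ c₀ w'
    insert {a = a} θ≤τ sa (end θ≤t reached) =
      a ∷ [] , ε , step θ≤τ sa (end (Step-time-upper sa (λ p → ≼-clock (reached p))) reached)
    insert {a = a} {w = b ∷ w} θ≤τ sa (step θ≤σ sb sorted) with inOrder⊎swappable sa sb
    ... | inj₁ τ≤σ = a ∷ b ∷ w , ε , step θ≤τ sa (step τ≤σ sb sorted)
    ... | inj₂ (disj , σ≤τ) with Step-commute disj sa sb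
    ...   | _ , sb' , sa' with insert σ≤τ sa' sorted
    ...     | w' , w'∼aw , sorted' =
      b ∷ w' , ∼-cons b w'∼aw ◅◅ swap [] b a w (λ p db da → disj p da db) ◅ ε ,
      step θ≤σ sb' sorted'

    sort : ∀ {θ c u} → (∀ p → θ ≤ clock (c p)) → Schedule c u →
           ∃ λ w → w ∼ u × SortedSchedule θ c w
    sort θ≤c (end reached) = [] , ε , end (≤-trans (θ≤c zero) (≼-clock (reached zero))) reached
    sort θ≤c (_∷_ {b} s schedule)
      with sort (λ p → ≤-trans (θ≤c p) (Step-clock-mono s p)) schedule
    ... | w , w∼u , sorted with insert (Step-time-lower θ≤c s) s sorted
    ...   | w' , w'∼bw , sorted' = w' , w'∼bw ◅◅ ∼-cons b w∼u , sorted'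

    SortedSchedule⇒GRun : ∀ {θ c w} → SortedSchedule θ c w → GRun (states c , gval c θ) w (q' , v')
    SortedSchedule⇒GRun {θ} (end θ≤t reached) =
      t v' - θ , GDelay-up-to θ≤t (λ p → ≼-state (reached p)) (λ p → ≼-offset (reached p))
    SortedSchedule⇒GRun {θ} {c} (step {τ = τ} {c₁ = c₁} θ≤τ s sorted) =
      τ - θ , (states c , gval c τ) , (states c₁ , gval c₁ τ) ,
      GDelay-up-to θ≤τ (λ _ → refl) (λ _ _ → refl) , Step⇒GAct s , SortedSchedule⇒GRun sorted

  LRun⇒Schedule : ∀ {q ν u q' ν'} → Synchronized ν' → LRun (q , ν) u (q' , ν') →
                  Schedule q' (global ν') (conf q ν) u
  LRun⇒Schedule {u = []} synced' (_ , delays) =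
    end λ p → ≼-trans (LDelays⇒≼ delays p) (idle refl (λ _ → refl) (≤-reflexive (synced' p zero)))
  LRun⇒Schedule {u = b ∷ u} synced' (_ , _ , _ , delays , act , run) =
    Step-resp-≼ˡ (LDelays⇒≼ delays) (LAct⇒Step (proj₂ (Σ-cover b)) act) ∷ LRun⇒Schedule synced' run

lemma11 : (F : OrderedField) (N : NetworkOver F) →
    let open NetworkOver N in
    (q q' : GState) (ν ν' : LVal) (u : Word) →
    IsLVal ν → IsLVal ν' → Synchronized ν → Synchronized ν' →
    LRun (q , ν) u (q' , ν') →
    ∃ λ w → (w ∼ u) × GRun (q , global ν) w (q' , global ν')
lemma11 F N q q' ν ν' u _ _ synced synced' run =
  let (w , w∼u , sorted) = sort q' (global ν') (λ p → ≤-reflexive (synced zero p))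
                                (LRun⇒Schedule synced' run)
  in w , w∼u , SortedSchedule⇒GRun q' (global ν') sorted
  where
  open NetworkOver N
  open LocalToGlobal F N
  open IsTotalOrder isTotalOrder using () renaming (reflexive to ≤-reflexive)
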